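{- Every computational path generated from the path $\mathrm{base}=_{loop}\mathrm{base}:S^1$ (by reflexivity, symmetry and transitivity) is rw-equal to a path $loop^n$ for some $n\in\mathbb{Z}$.
   Context: Computational paths: $a=_s b:A$ denotes a computational path, i.e. a finite composition of rewrites, each an application of an axiom or inference rule of the $\lambda\beta\eta$-equality theory of type theory. These include reflexivity $\rho$, symmetry $\sigma$ and transitivity $\tau$. The composition of loops is $r\circ s:=\tau(s,r)$. rw-equality is the reflexive, symmetric and transitive closure of the rewrite system $LND_{EQ}$-$TRS$. Its rules include $\sigma(\rho)\rhd\rho$, $\sigma(\sigma(r))\rhd r$, $\tau(r,\sigma(r))\rhd\rho$, $\tau(\sigma(r),r)\rhd\rho$, $\tau(r,\rho)\rhd r$, $\tau(\rho,r)\rhd r$ and $\tau(\tau(t,r),s)\rhd\tau(t,\tau(r,s))$. The circle $S^1$ is generated by a point $\mathrm{base}$ and a path $\mathrm{base}=_{loop}\mathrm{base}$. The powers of $loop$ are defined by $loop^0=\rho$, $loop^{ -1}=\sigma(loop)$, $loop^{n+1}=loop^n\circ loop$ for $n\ge0$, and $loop^{ -(n+1)}=loop^{ -n}\circ\sigma(loop)$ for $n\ge 0$. -}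

module Defs where

open import Data.Nat using (ℕ; zero; suc)
open import Data.Integer using (ℤ; +_; -[1+_])

-- Computational paths base = base in S¹ generated from loop by ρ, σ, τ.
data Path : Set where
  loop : Path
  ρ    : Path
  σ    : Path → Path
  τ    : Path → Path → Path

_∘ₚ_ : Path → Path → Path
r ∘ₚ s = τ s r

-- One-step rewriting of LND_EQ-TRS (the rules relevant to ρ, σ, τ),
-- closed under subterm contexts.
data _▷_ : Path → Path → Set where
  σρ    : σ ρ ▷ ρ
  σσ    : ∀ r → σ (σ r) ▷ r
  τr-σr : ∀ r → τ r (σ r) ▷ ρ
  τσr-r : ∀ r → τ (σ r) r ▷ ρ
  τr-ρ  : ∀ r → τ r ρ ▷ r
  τρ-r  : ∀ r → τ ρ r ▷ r
  ττ    : ∀ t r s → τ (τ t r) s ▷ τ t (τ r s)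
  cong-σ  : ∀ {r r'} → r ▷ r' → σ r ▷ σ r'
  cong-τˡ : ∀ {r r' s} → r ▷ r' → τ r s ▷ τ r' s
  cong-τʳ : ∀ {r s s'} → s ▷ s' → τ r s ▷ τ r s'

data _=rw_ : Path → Path → Set where
  rw-step  : ∀ {r s} → r ▷ s → r =rw s
  rw-refl  : ∀ {r} → r =rw r
  rw-sym   : ∀ {r s} → r =rw s → s =rw r
  rw-trans : ∀ {r s t} → r =rw s → s =rw t → r =rw t

loop^ : ℤ → Path
loop^ (+ zero)        = ρ
loop^ (+ suc n)       = loop^ (+ n) ∘ₚ loop
loop^ -[1+ zero ]     = σ loop
loop^ -[1+ suc n ]    = loop^ -[1+ n ] ∘ₚ σ loop

-- Up to rw-equality, loop^ is a homomorphism from (ℤ, +, -) into paths under τ and σ,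
-- so the integer obtained by reading loop as 1, ρ as 0, σ as negation and τ as addition
-- names a power of loop rw-equal to the given path.
module Submission where

open import Data.Integer using (ℤ; +_; -[1+_]; _+_; -_; 1ℤ; -1ℤ; suc; pred)
open import Data.Integer.Properties using (+-assoc; +-identityˡ; +-inverseʳ)
open import Data.Nat using (zero) renaming (suc to 1+)
open import Data.Product using (∃; _,_)
open import Relation.Binary.Bundles using (Setoid)
open import Relation.Binary.PropositionalEquality using (_≡_; refl; sym)
import Relation.Binary.Reasoning.Setoid as SetoidReasoning

open import Defs

rw-setoid : Setoid _ _
rw-setoid = record
  { Carrier       = Path
  ; _≈_           = _=rw_
  ; isEquivalence = record { refl = rw-refl ; sym = rw-sym ; trans = rw-trans }
  }

open SetoidReasoning rw-setoid

▷⇒=rw˘ : ∀ {r s} → r ▷ s → s =rw r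
▷⇒=rw˘ r▷s = rw-sym (rw-step r▷s)

σ-cong : ∀ {r r'} → r =rw r' → σ r =rw σ r'
σ-cong (rw-step r▷r') = rw-step (cong-σ r▷r')
σ-cong rw-refl        = rw-refl
σ-cong (rw-sym p)     = rw-sym (σ-cong p)
σ-cong (rw-trans p q) = rw-trans (σ-cong p) (σ-cong q)

τ-congˡ : ∀ {r r' s} → r =rw r' → τ r s =rw τ r' s
τ-congˡ (rw-step r▷r') = rw-step (cong-τˡ r▷r')
τ-congˡ rw-refl        = rw-refl
τ-congˡ (rw-sym p)     = rw-sym (τ-congˡ p)
τ-congˡ (rw-trans p q) = rw-trans (τ-congˡ p) (τ-congˡ q)

τ-congʳ : ∀ {r s s'} → s =rw s' → τ r s =rw τ r s'
τ-congʳ (rw-step s▷s') = rw-step (cong-τʳ s▷s')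
τ-congʳ rw-refl        = rw-refl
τ-congʳ (rw-sym p)     = rw-sym (τ-congʳ p)
τ-congʳ (rw-trans p q) = rw-trans (τ-congʳ p) (τ-congʳ q)

τ-cong : ∀ {r r' s s'} → r =rw r' → s =rw s' → τ r s =rw τ r' s'
τ-cong p q = rw-trans (τ-congˡ p) (τ-congʳ q)

τ-cancelˡ : ∀ r s → τ r (τ (σ r) s) =rw s
τ-cancelˡ r s = begin
  τ r (τ (σ r) s) ≈⟨ ▷⇒=rw˘ (ττ r (σ r) s) ⟩
  τ (τ r (σ r)) s ≈⟨ τ-congˡ (rw-step (τr-σr r)) ⟩
  τ ρ s           ≈⟨ rw-step (τρ-r s) ⟩
  s               ∎

τ-cancelˡ˘ : ∀ r s → τ (σ r) (τ r s) =rw s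
τ-cancelˡ˘ r s = begin
  τ (σ r) (τ r s) ≈⟨ ▷⇒=rw˘ (ττ (σ r) r s) ⟩
  τ (τ (σ r) r) s ≈⟨ τ-congˡ (rw-step (τσr-r r)) ⟩
  τ ρ s           ≈⟨ rw-step (τρ-r s) ⟩
  s               ∎

σ-unique : ∀ {r s} → τ r s =rw ρ → σ r =rw s
σ-unique {r} {s} rs≈ρ = begin
  σ r             ≈⟨ ▷⇒=rw˘ (τr-ρ (σ r)) ⟩
  τ (σ r) ρ       ≈⟨ τ-congʳ (rw-sym rs≈ρ) ⟩
  τ (σ r) (τ r s) ≈⟨ τ-cancelˡ˘ r s ⟩
  s               ∎

loop^-cong : ∀ {a b} → a ≡ b → loop^ a =rw loop^ b
loop^-cong refl = rw-refl

-- As r ∘ₚ s = τ s r, loop^ (suc a) unfolds to τ loop (loop^ a) (for a ≥ 0), not τ (loop^ a) loop.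
τ-loop-loop^ : ∀ a → τ loop (loop^ a) =rw loop^ (suc a)
τ-loop-loop^ (+ n)       = rw-refl
τ-loop-loop^ -[1+ zero ] = rw-step (τr-σr loop)
τ-loop-loop^ -[1+ 1+ n ] = τ-cancelˡ loop (loop^ -[1+ n ])

τ-σloop-loop^ : ∀ a → τ (σ loop) (loop^ a) =rw loop^ (pred a)
τ-σloop-loop^ (+ zero)  = rw-step (τr-ρ (σ loop))
τ-σloop-loop^ (+ 1+ n)  = τ-cancelˡ˘ loop (loop^ (+ n))
τ-σloop-loop^ -[1+ n ]  = rw-refl

loop^-+ : ∀ a b → τ (loop^ a) (loop^ b) =rw loop^ (a + b)
loop^-+ (+ zero) b = begin
  τ ρ (loop^ b)       ≈⟨ rw-step (τρ-r (loop^ b)) ⟩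
  loop^ b             ≈⟨ loop^-cong (sym (+-identityˡ b)) ⟩
  loop^ (+ zero + b)  ∎
loop^-+ (+ 1+ n) b = begin
  τ (τ loop (loop^ (+ n))) (loop^ b) ≈⟨ rw-step (ττ loop (loop^ (+ n)) (loop^ b)) ⟩
  τ loop (τ (loop^ (+ n)) (loop^ b)) ≈⟨ τ-congʳ (loop^-+ (+ n) b) ⟩
  τ loop (loop^ (+ n + b))           ≈⟨ τ-loop-loop^ (+ n + b) ⟩
  loop^ (1ℤ + (+ n + b))             ≈⟨ loop^-cong (sym (+-assoc 1ℤ (+ n) b)) ⟩
  loop^ (+ 1+ n + b)                 ∎
loop^-+ -[1+ zero ] b = τ-σloop-loop^ b
loop^-+ -[1+ 1+ n ] b = begin
  τ (τ (σ loop) (loop^ -[1+ n ])) (loop^ b) ≈⟨ rw-step (ττ (σ loop) (loop^ -[1+ n ]) (loop^ b)) ⟩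
  τ (σ loop) (τ (loop^ -[1+ n ]) (loop^ b)) ≈⟨ τ-congʳ (loop^-+ -[1+ n ] b) ⟩
  τ (σ loop) (loop^ (-[1+ n ] + b))         ≈⟨ τ-σloop-loop^ (-[1+ n ] + b) ⟩
  loop^ (-1ℤ + (-[1+ n ] + b))              ≈⟨ loop^-cong (sym (+-assoc -1ℤ -[1+ n ] b)) ⟩
  loop^ (-[1+ 1+ n ] + b)                   ∎

σ-loop^ : ∀ a → σ (loop^ a) =rw loop^ (- a)
σ-loop^ a = σ-unique (rw-trans (loop^-+ a (- a)) (loop^-cong (+-inverseʳ a)))

lemma5p22 : (p : Path) → ∃ λ (n : ℤ) → p =rw loop^ n
lemma5p22 loop = + 1 , ▷⇒=rw˘ (τr-ρ loop)
lemma5p22 ρ    = + 0 , rw-refl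
lemma5p22 (σ p) with lemma5p22 p
... | n , p≈loop^n = - n , rw-trans (σ-cong p≈loop^n) (σ-loop^ n)
lemma5p22 (τ p q) with lemma5p22 p | lemma5p22 q
... | m , p≈loop^m | n , q≈loop^n =
  m + n , rw-trans (τ-cong p≈loop^m q≈loop^n) (loop^-+ m n)
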